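{- Let $n\geq 1$ and $k\geq 3$ be integers, and let $H_{n,k}$ be the Hamming graph. Then $\dim_f(H_{n,k})=\frac{k}{2}$.
   Context: The Hamming graph $H_{n,k}$ has vertex set $\{(x_1,\ldots,x_n): 1\leq x_i\leq k\}$, two vertices being adjacent iff they differ in exactly one coordinate (equivalently, it is the cartesian product of $n$ copies of the complete graph $K_k$). For vertices $x,y$ of a connected graph $G$, $R\{x,y\}$ is the set of vertices $z$ with $d(x,z)\neq d(y,z)$. A resolving function of $G$ is $f:V(G)\to[0,1]$ with $\sum_{z\in R\{x,y\}}f(z)\geq 1$ for all distinct $x,y$; $\dim_f(G)$ is the minimum of $\sum_{v\in V(G)}f(v)$ over all resolving functions $f$.
   Formalization: Resolving functions of $H_{n,k}$ take values in the rationals of the unit interval rather than in the real interval $[0,1]$. -}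

module Defs where

open import Data.Nat using (ℕ; zero; suc; _≤_; _≟_)
open import Data.Fin using (Fin)
open import Data.Fin.Properties using () renaming (_≟_ to _≟F_)
open import Data.Vec using (Vec; []; _∷_; lookup)
open import Data.List using (List; []; _∷_; map; concatMap; filter; foldr)
open import Data.List using () renaming ([_] to [_]ᴸ)
open import Data.List.Base using ()
open import Data.Fin using () renaming (zero to fzero)
open import Data.Product using (Σ; ∃; _×_; _,_)
open import Relation.Nullary using (¬_)
open import Relation.Nullary.Decidable using (¬?)
open import Relation.Binary.PropositionalEquality using (_≡_; _≢_)
open import Data.Rational using (ℚ; 0ℚ; 1ℚ; _+_) renaming (_≤_ to _≤ℚ_)
import Data.List as L

-- Vertices of the Hamming graph H_{n,k}: words of length n over Fin k
-- (Fin k plays the role of {1,...,k}).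
Vertex : ℕ → ℕ → Set
Vertex n k = Vec (Fin k) n

allFinList : (k : ℕ) → List (Fin k)
allFinList k = L.allFin k

vertices : (n k : ℕ) → List (Vertex n k)
vertices zero    k = [ [] ]ᴸ
vertices (suc n) k = concatMap (λ a → map (a ∷_) (vertices n k)) (allFinList k)

Adj : {n k : ℕ} → Vertex n k → Vertex n k → Set
Adj {n} x y = Σ (Fin n) λ i → (lookup x i ≢ lookup y i) × (∀ j → j ≢ i → lookup x j ≡ lookup y j)

data Walk {n k : ℕ} : Vertex n k → Vertex n k → ℕ → Set where
  nil  : ∀ {x} → Walk x x 0
  cons : ∀ {x y z m} → Adj x y → Walk y z m → Walk x z (suc m)

IsDist : {n k : ℕ} → Vertex n k → Vertex n k → ℕ → Set
IsDist x z m = Walk x z m × (∀ m' → Walk x z m' → m ≤ m')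

sumOver : {A : Set} → List A → (A → ℚ) → ℚ
sumOver xs f = foldr (λ a s → f a + s) 0ℚ xs

resolvingSet : {n k : ℕ} → (Vertex n k → Vertex n k → ℕ) → Vertex n k → Vertex n k → List (Vertex n k)
resolvingSet {n} {k} d x y = filter (λ z → ¬? (d x z ≟ d y z)) (vertices n k)

IsResolvingFunction : {n k : ℕ} → (Vertex n k → Vertex n k → ℕ) → (Vertex n k → ℚ) → Set
IsResolvingFunction {n} {k} d f =
  (∀ v → (0ℚ ≤ℚ f v) × (f v ≤ℚ 1ℚ)) ×
  (∀ x y → x ≢ y → 1ℚ ≤ℚ sumOver (resolvingSet d x y) f)

weight : {n k : ℕ} → (Vertex n k → ℚ) → ℚ
weight {n} {k} f = sumOver (vertices n k) f

FracDimIs : {n k : ℕ} → (Vertex n k → Vertex n k → ℕ) → ℚ → Set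
FracDimIs {n} {k} d q =
  (Σ (Vertex n k → ℚ) λ f → IsResolvingFunction d f × (weight f ≡ q)) ×
  (∀ (f : Vertex n k → ℚ) → IsResolvingFunction d f → q ≤ℚ weight f)

-- The graph distance is the Hamming distance. Upper bound: for x ≠ y at most (k - 2) k^(n-1)
-- vertices are equidistant from x and y, so |R{x,y}| ≥ 2 k^(n-1) and the constant function
-- 1 / (2 k^(n-1)) is resolving, of weight k/2. Lower bound: if x and y differ only in their
-- first letter, a and b, every vertex resolving them starts with a or b; hence the weights
-- F c of the k layers {z : z₁ = c} satisfy F a + F b ≥ 1 for all a ≠ b, which forces
-- F 1 + ⋯ + F k ≥ k/2.

module Submission where

open import Defs
open import Data.Nat using (ℕ; _≤_)
open import Data.Integer using (+_)
open import Data.Rational using (_/_)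

open import Algebra.Bundles using (CommutativeMonoid; CommutativeRing)
open import Data.Bool using (true; false; if_then_else_)
open import Data.Empty using (⊥-elim)
open import Data.Fin as Fin using (Fin; punchIn; punchOut)
open import Data.Fin.Properties using (_≟_; suc-injective; punchIn-punchOut; punchInᵢ≢i; punchIn-injective)
import Data.Integer as ℤ
open import Data.Integer.Solver renaming (module +-*-Solver to ℤ-Solver)
open import Data.List as List using (List; []; _∷_; _++_; map; filter; length; concatMap; tabulate)
import Data.List.Properties as List
open import Data.List.Relation.Unary.All using (universal)
open import Data.Nat as ℕ using (zero; suc; _+_; _*_; _^_; z≤n; s≤s; NonZero)
open import Data.Nat.Properties as ℕ using (≤-refl; ≤-trans; ≤-reflexive)
open import Data.Product using (Σ; _,_; proj₁; proj₂) renaming (_×_ to _∧_)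
open import Data.Rational as ℚ using (ℚ; 0ℚ; 1ℚ; ½)
import Data.Rational.Properties as ℚ
open import Data.Rational.Solver renaming (module +-*-Solver to ℚ-Solver)
import Data.Rational.Unnormalised as ℚᵘ
import Data.Rational.Unnormalised.Properties as ℚᵘ
open import Data.Vec as Vec using ([]; _∷_; lookup)
open import Data.Vec.Functional using (Vector; removeAt; replicate)
open import Data.Vec.Properties using (tabulate∘lookup; tabulate-cong; ∷-injectiveˡ; ≡-dec)
open import Function using (_∘_)
open import Relation.Binary.PropositionalEquality as ≡
  using (_≡_; _≢_; refl; sym; trans; cong; cong₂; subst₂)
open import Relation.Nullary using (does; yes; no; ¬_)
open import Relation.Nullary.Decidable using (dec-true; dec-false; ¬?)
open import Relation.Unary using (Pred; Decidable)

open import Algebra.Properties.AbelianGroup ℚ.+-0-abelianGroup using (xyx⁻¹≈y)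
open import Algebra.Properties.CommutativeSemigroup ℕ.*-commutativeSemigroup using (x∙yz≈y∙xz)
open import Algebra.Properties.Semiring.Mult (CommutativeRing.semiring ℚ.+-*-commutativeRing)
  using (_×_; ×-assocˡ; ×-assoc-*; ×-comm-*)

private variable
  n k : ℕ

-- Hamming distance

diff : Fin k → Fin k → ℕ
diff a b = if does (a ≟ b) then 0 else 1

diff-refl : (a : Fin k) → diff a a ≡ 0
diff-refl a rewrite dec-true (a ≟ a) refl = refl

diff-≢ : {a b : Fin k} → a ≢ b → diff a b ≡ 1
diff-≢ {a = a} {b} a≢b rewrite dec-false (a ≟ b) a≢b = refl

diff≤1 : (a b : Fin k) → diff a b ≤ 1
diff≤1 a b with does (a ≟ b)
... | true  = z≤n
... | false = ≤-refl

hamming : Vertex n k → Vertex n k → ℕ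
hamming []      []      = 0
hamming (a ∷ x) (b ∷ y) = diff a b + hamming x y

hamming-refl : (x : Vertex n k) → hamming x x ≡ 0
hamming-refl []      = refl
hamming-refl (a ∷ x) = cong₂ _+_ (diff-refl a) (hamming-refl x)

lookup-ext : (x y : Vertex n k) → (∀ i → lookup x i ≡ lookup y i) → x ≡ y
lookup-ext x y eq = trans (sym (tabulate∘lookup x)) (trans (tabulate-cong eq) (tabulate∘lookup y))

hamming-adj : {x y : Vertex n k} → Adj x y → (z : Vertex n k) → hamming x z ≤ suc (hamming y z)
hamming-adj {x = a ∷ x} {b ∷ y} (Fin.zero , _ , same) (c ∷ z)
  rewrite lookup-ext x y (λ j → same (Fin.suc j) (λ ())) =
  ℕ.+-monoˡ-≤ (hamming y z) (≤-trans (diff≤1 a c) (s≤s z≤n))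
hamming-adj {x = a ∷ x} {b ∷ y} (Fin.suc i , differ , same) (c ∷ z) rewrite same Fin.zero (λ ()) =
  ≤-trans (ℕ.+-monoʳ-≤ (diff b c) (hamming-adj {x = x} {y} (i , differ , same′) z))
          (≤-reflexive (ℕ.+-suc (diff b c) (hamming y z)))
  where
  same′ : ∀ j → j ≢ i → lookup x j ≡ lookup y j
  same′ j j≢i = same (Fin.suc j) (j≢i ∘ suc-injective)

hamming≤walk : {x z : Vertex n k} {m : ℕ} → Walk x z m → hamming x z ≤ m
hamming≤walk {x = x} nil = ≤-reflexive (hamming-refl x)
hamming≤walk {x = x} {z} (cons {y = y} adj w) =
  ≤-trans (hamming-adj {x = x} {y} adj z) (s≤s (hamming≤walk w))

walk-∷ : (a : Fin k) {x y : Vertex n k} {m : ℕ} → Walk x y m → Walk (a ∷ x) (a ∷ y) m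
walk-∷ a nil = nil
walk-∷ a (cons (i , differ , same) w) =
  cons (Fin.suc i , differ , λ { Fin.zero _ → refl ; (Fin.suc j) j≢i → same j (j≢i ∘ cong Fin.suc) })
       (walk-∷ a w)

hamming-walk : (x z : Vertex n k) → Walk x z (hamming x z)
hamming-walk []      []      = nil
hamming-walk (a ∷ x) (c ∷ z) with a ≟ c
... | yes refl = walk-∷ a (hamming-walk x z)
... | no  a≢c  = cons (Fin.zero , a≢c , λ { Fin.zero 0≢0 → ⊥-elim (0≢0 refl) ; (Fin.suc j) _ → refl })
                      (walk-∷ c (hamming-walk x z))

dist≡hamming : (d : Vertex n k → Vertex n k → ℕ) → (∀ x z → IsDist x z (d x z)) →
               ∀ x z → d x z ≡ hamming x z
dist≡hamming d isDist x z =
  ℕ.≤-antisym (proj₂ (isDist x z) _ (hamming-walk x z)) (hamming≤walk (proj₁ (isDist x z)))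

resolvingSet-hamming : (d : Vertex n k → Vertex n k → ℕ) → (∀ x z → IsDist x z (d x z)) →
                       (x y : Vertex n k) → resolvingSet d x y ≡ resolvingSet hamming x y
resolvingSet-hamming d isDist x y =
  List.filter-≐ _ _ ( (λ {z} → subst₂ (λ u v → ¬ u ≡ v) (d≡h x z) (d≡h y z))
                    , (λ {z} → subst₂ (λ u v → ¬ u ≡ v) (sym (d≡h x z)) (sym (d≡h y z))))
                (vertices _ _)
  where
  d≡h : ∀ x z → d x z ≡ hamming x z
  d≡h = dist≡hamming d isDist

-- Finite sums

module Sums {c ℓ} (M : CommutativeMonoid c ℓ) where
  open CommutativeMonoid M
    using (Carrier; _≈_; setoid; identityʳ)
    renaming (_∙_ to _+ᴹ_; ε to 0ᴹ; ∙-congˡ to +ᴹ-congˡ; trans to ≈-trans)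
  open import Algebra.Properties.CommutativeMonoid.Sum M public
    using (sum; sum-remove; sum-cong-≋; sum-cong-≗; sum-replicate-zero)
  open import Relation.Binary.Reasoning.Setoid setoid

  sum-concatMap-tabulate : {A B : Set} (φ : List B → Carrier) →
    φ [] ≈ 0ᴹ → (∀ xs ys → φ (xs ++ ys) ≈ φ xs +ᴹ φ ys) →
    ∀ {n} (g : A → List B) (h : Fin n → A) → φ (concatMap g (tabulate h)) ≈ sum (φ ∘ g ∘ h)
  sum-concatMap-tabulate φ φ-[] φ-++ {zero}  g h = φ-[]
  sum-concatMap-tabulate φ φ-[] φ-++ {suc n} g h =
    ≈-trans (φ-++ (g (h Fin.zero)) _) (+ᴹ-congˡ (sum-concatMap-tabulate φ φ-[] φ-++ g (h ∘ Fin.suc)))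

  sum-vertices : (φ : List (Vertex (suc n) k) → Carrier) →
    φ [] ≈ 0ᴹ → (∀ xs ys → φ (xs ++ ys) ≈ φ xs +ᴹ φ ys) →
    φ (vertices (suc n) k) ≈ sum (λ c → φ (map (c ∷_) (vertices n k)))
  sum-vertices {n} φ φ-[] φ-++ =
    sum-concatMap-tabulate φ φ-[] φ-++ (λ c → map (c ∷_) (vertices n _)) (λ c → c)

  sum-remove₂ : ∀ {n} {a b : Fin (suc (suc n))} (a≢b : a ≢ b) (t : Vector Carrier (suc (suc n))) →
                sum t ≈ t a +ᴹ (t b +ᴹ sum (removeAt (removeAt t a) (punchOut a≢b)))
  sum-remove₂ {n} {a} {b} a≢b t = begin
    sum t                                 ≈⟨ sum-remove {i = a} t ⟩
    t a +ᴹ sum (removeAt t a)             ≈⟨ +ᴹ-congˡ (sum-remove {i = b′} (removeAt t a)) ⟩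
    t a +ᴹ (t (punchIn a b′) +ᴹ sum rest) ≡⟨ cong (λ c → t a +ᴹ (t c +ᴹ sum rest)) (punchIn-punchOut a≢b) ⟩
    t a +ᴹ (t b +ᴹ sum rest)              ∎
    where
    b′ : Fin (suc n)
    b′ = punchOut a≢b
    rest : Vector Carrier n
    rest = removeAt (removeAt t a) b′

  sum-supported₂ : ∀ {n} {a b : Fin (suc (suc n))} (t : Vector Carrier (suc (suc n))) → a ≢ b →
                   (∀ c → c ≢ a → c ≢ b → t c ≈ 0ᴹ) → sum t ≈ t a +ᴹ t b
  sum-supported₂ {n} {a} {b} t a≢b vanish = begin
    sum t                     ≈⟨ sum-remove₂ a≢b t ⟩
    t a +ᴹ (t b +ᴹ sum rest)  ≈⟨ +ᴹ-congˡ (+ᴹ-congˡ rest-sum≈0) ⟩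
    t a +ᴹ (t b +ᴹ 0ᴹ)        ≈⟨ +ᴹ-congˡ (identityʳ (t b)) ⟩
    t a +ᴹ t b                ∎
    where
    b′ : Fin (suc n)
    b′ = punchOut a≢b
    rest : Vector Carrier n
    rest = removeAt (removeAt t a) b′
    rest≈0 : ∀ i → rest i ≈ replicate n 0ᴹ i
    rest≈0 i = vanish _ (punchInᵢ≢i a _)
      (λ eq → punchInᵢ≢i b′ i (punchIn-injective a _ _ (trans eq (sym (punchIn-punchOut a≢b)))))
    rest-sum≈0 : sum rest ≈ 0ᴹ
    rest-sum≈0 = ≈-trans (sum-cong-≋ rest≈0) (sum-replicate-zero n)

module ℕΣ = Sums ℕ.+-0-commutativeMonoid
module ℚΣ = Sums ℚ.+-0-commutativeMonoid

filter-map : {A B : Set} {p : _} {P : Pred B p} (P? : Decidable P) (f : A → B) (xs : List A) →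
             filter P? (map f xs) ≡ map f (filter (P? ∘ f) xs)
filter-map P? f []       = refl
filter-map P? f (x ∷ xs) with does (P? (f x))
... | true  = cong (f x ∷_) (filter-map P? f xs)
... | false = filter-map P? f xs

length-filter-∁ : {A : Set} {p : _} {P : Pred A p} (P? : Decidable P) (xs : List A) →
                  length (filter (¬? ∘ P?) xs) + length (filter P? xs) ≡ length xs
length-filter-∁ P? []       = refl
length-filter-∁ P? (x ∷ xs) with P? x
... | yes _ = trans (ℕ.+-suc _ _) (cong suc (length-filter-∁ P? xs))
... | no  _ = cong suc (length-filter-∁ P? xs)

sum≤ : ∀ {n} (t : Vector ℕ n) {B : ℕ} → (∀ i → t i ≤ B) → ℕΣ.sum t ≤ n * B
sum≤ {zero}  t t≤B = z≤n
sum≤ {suc n} t t≤B = ℕ.+-mono-≤ (t≤B Fin.zero) (sum≤ (t ∘ Fin.suc) (t≤B ∘ Fin.suc))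

sum-const : ∀ n (c : ℕ) → ℕΣ.sum {n} (λ _ → c) ≡ n * c
sum-const zero    c = refl
sum-const (suc n) c = cong (_+_ c) (sum-const n c)

length-vertices : ∀ n k → length (vertices n k) ≡ k ^ n
length-vertices zero    k = refl
length-vertices (suc n) k =
  trans (ℕΣ.sum-vertices {n = n} {k = k} length refl (λ xs ys → List.length-++ xs))
  (trans (ℕΣ.sum-cong-≗ (λ c → trans (List.length-map (c ∷_) (vertices n k)) (length-vertices n k)))
         (sum-const k (k ^ n)))

length-filter-vertices : {p : _} {P : Pred (Vertex (suc n) k) p} (P? : Decidable P) →
  length (filter P? (vertices (suc n) k)) ≡ ℕΣ.sum (λ c → length (filter (P? ∘ (c ∷_)) (vertices n k)))
length-filter-vertices {n} {k} P? =
  trans (ℕΣ.sum-vertices {n = n} {k = k} (length ∘ filter P?) refl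
          (λ xs ys → trans (cong length (List.filter-++ P? xs ys)) (List.length-++ (filter P? xs))))
        (ℕΣ.sum-cong-≗ (λ c → trans (cong length (filter-map P? (c ∷_) (vertices n k)))
                                    (List.length-map _ (filter (P? ∘ (c ∷_)) (vertices n k)))))

-- Counting equidistant vertices

tied? : (x y : Vertex n k) (p q : ℕ) → Decidable (λ z → p + hamming x z ≡ q + hamming y z)
tied? x y p q z = p + hamming x z ℕ.≟ q + hamming y z

-- The offsets p and q carry the distances accumulated on the letters already stripped off.
ties : Vertex n k → Vertex n k → ℕ → ℕ → ℕ
ties x y p q = length (filter (tied? x y p q) (vertices _ _))

ties-∷ : (a b : Fin k) (x y : Vertex n k) (p q : ℕ) →
         ties (a ∷ x) (b ∷ y) p q ≡ ℕΣ.sum (λ c → ties x y (p + diff a c) (q + diff b c))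
ties-∷ {n = n} a b x y p q =
  trans (length-filter-vertices (tied? (a ∷ x) (b ∷ y) p q))
        (ℕΣ.sum-cong-≗ λ c → cong length
          (List.filter-≐ _ (tied? x y (p + diff a c) (q + diff b c)) (reassoc c , reassoc′ c) (vertices n _)))
  where
  reassoc : ∀ c {u} → p + (diff a c + hamming x u) ≡ q + (diff b c + hamming y u) →
            p + diff a c + hamming x u ≡ q + diff b c + hamming y u
  reassoc c = subst₂ _≡_ (sym (ℕ.+-assoc p _ _)) (sym (ℕ.+-assoc q _ _))
  reassoc′ : ∀ c {u} → p + diff a c + hamming x u ≡ q + diff b c + hamming y u →
             p + (diff a c + hamming x u) ≡ q + (diff b c + hamming y u)
  reassoc′ c = subst₂ _≡_ (ℕ.+-assoc p _ _) (ℕ.+-assoc q _ _)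

ties-diagonal≤ : (x : Vertex n k) (p q : ℕ) → ties x x p q ≤ k ^ n
ties-diagonal≤ {n} {k} x p q =
  ≤-trans (List.length-filter (tied? x x p q) (vertices n k)) (≤-reflexive (length-vertices n k))

ties-diagonal-≢ : (x : Vertex n k) {p q : ℕ} → p ≢ q → ties x x p q ≡ 0
ties-diagonal-≢ {n} {k} x {p} {q} p≢q = cong length (List.filter-none (tied? x x p q)
  (universal (λ z → p≢q ∘ ℕ.+-cancelʳ-≡ (hamming x z) p q) (vertices n k)))

module _ {a b : Fin k} (a≢b : a ≢ b) {p q : ℕ} where

  tied-at-a⇒p≡1+q : p + diff a a ≡ q + diff b a → p ≡ suc q
  tied-at-a⇒p≡1+q eq = begin
    p            ≡⟨ ℕ.+-identityʳ p ⟨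
    p + 0        ≡⟨ cong (_+_ p) (diff-refl a) ⟨
    p + diff a a ≡⟨ eq ⟩
    q + diff b a ≡⟨ cong (_+_ q) (diff-≢ (a≢b ∘ sym)) ⟩
    q + 1        ≡⟨ ℕ.+-comm q 1 ⟩
    suc q        ∎
    where open ≡.≡-Reasoning

  tied-at-b⇒1+p≡q : p + diff a b ≡ q + diff b b → suc p ≡ q
  tied-at-b⇒1+p≡q eq = begin
    suc p        ≡⟨ ℕ.+-comm 1 p ⟩
    p + 1        ≡⟨ cong (_+_ p) (diff-≢ a≢b) ⟨
    p + diff a b ≡⟨ eq ⟩
    q + diff b b ≡⟨ cong (_+_ q) (diff-refl b) ⟩
    q + 0        ≡⟨ ℕ.+-identityʳ q ⟩
    q            ∎
    where open ≡.≡-Reasoning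

  tied-elsewhere⇒p≡q : {c : Fin k} → c ≢ a → c ≢ b → p + diff a c ≡ q + diff b c → p ≡ q
  tied-elsewhere⇒p≡q c≢a c≢b eq = ℕ.+-cancelʳ-≡ 1 p q
    (trans (cong (_+_ p) (sym (diff-≢ (c≢a ∘ sym)))) (trans eq (cong (_+_ q) (diff-≢ (c≢b ∘ sym)))))

2+n≢n : ∀ n → suc (suc n) ≢ n
2+n≢n zero    ()
2+n≢n (suc n) = 2+n≢n n ∘ ℕ.suc-injective

-- Head c is tied when p + [a ≠ c] = q + [b ≠ c]: if p = q neither a nor b is, otherwise at most one head is.
sum-tied-heads≤ : {m : ℕ} .{{_ : NonZero m}} {a b : Fin (2 + m)} → a ≢ b → (p q : ℕ) →
  (t : Vector ℕ (2 + m)) {B : ℕ} → (∀ c → t c ≤ B) →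
  (∀ c → p + diff a c ≢ q + diff b c → t c ≡ 0) → ℕΣ.sum t ≤ m * B
sum-tied-heads≤ {m} {a} {b} a≢b p q t {B} t≤B untied⇒0 with p ℕ.≟ q
... | yes refl = begin
  ℕΣ.sum t                  ≡⟨ ℕΣ.sum-remove₂ a≢b t ⟩
  t a + (t b + ℕΣ.sum rest) ≡⟨ cong₂ (λ u v → u + (v + ℕΣ.sum rest))
                                     (untied⇒0 a (ℕ.1+n≢n ∘ sym ∘ tied-at-a⇒p≡1+q a≢b))
                                     (untied⇒0 b (ℕ.1+n≢n ∘ tied-at-b⇒1+p≡q a≢b)) ⟩
  ℕΣ.sum rest               ≤⟨ sum≤ rest (λ i → t≤B _) ⟩
  m * B                     ∎
  where
  open ℕ.≤-Reasoning
  rest : Vector ℕ m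
  rest = removeAt (removeAt t a) (punchOut a≢b)
... | no p≢q = begin
  ℕΣ.sum t  ≡⟨ ℕΣ.sum-supported₂ t a≢b untied-elsewhere ⟩
  t a + t b ≤⟨ at-most-one-tied ⟩
  B         ≤⟨ ℕ.m≤n*m B m ⟩
  m * B     ∎
  where
  open ℕ.≤-Reasoning
  untied-elsewhere : ∀ c → c ≢ a → c ≢ b → t c ≡ 0
  untied-elsewhere c c≢a c≢b = untied⇒0 c (p≢q ∘ tied-elsewhere⇒p≡q a≢b c≢a c≢b)
  at-most-one-tied : t a + t b ≤ B
  at-most-one-tied with p ℕ.≟ suc q
  ... | yes refl rewrite untied⇒0 b (2+n≢n q ∘ tied-at-b⇒1+p≡q a≢b) | ℕ.+-identityʳ (t a) = t≤B a
  ... | no p≢1+q rewrite untied⇒0 a (p≢1+q ∘ tied-at-a⇒p≡1+q a≢b) = t≤B b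

module _ {m : ℕ} .{{_ : NonZero m}} where

  ties-same-tail≤ : {a b : Fin (2 + m)} → a ≢ b → (x : Vertex n (2 + m)) (p q : ℕ) →
                    ties (a ∷ x) (b ∷ x) p q ≤ m * (2 + m) ^ n
  ties-same-tail≤ {n} {a} {b} a≢b x p q = begin
    ties (a ∷ x) (b ∷ x) p q                               ≡⟨ ties-∷ a b x x p q ⟩
    ℕΣ.sum (λ c → ties x x (p + diff a c) (q + diff b c))  ≤⟨ sum-tied-heads≤ a≢b p q _
                                                                (λ c → ties-diagonal≤ x _ _) (λ c → ties-diagonal-≢ x) ⟩
    m * (2 + m) ^ n                                        ∎
    where open ℕ.≤-Reasoning

  ties≤ : (x y : Vertex (suc n) (2 + m)) → x ≢ y → (p q : ℕ) → ties x y p q ≤ m * (2 + m) ^ n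
  ties≤ {zero}  (a ∷ []) (b ∷ []) x≢y p q = ties-same-tail≤ (x≢y ∘ cong (_∷ [])) [] p q
  ties≤ {suc n} (a ∷ x)  (b ∷ y)  x≢y p q with ≡-dec _≟_ x y
  ... | yes refl = ties-same-tail≤ (x≢y ∘ cong (_∷ x)) x p q
  ... | no  x≢y′ = begin
    ties (a ∷ x) (b ∷ y) p q                               ≡⟨ ties-∷ a b x y p q ⟩
    ℕΣ.sum (λ c → ties x y (p + diff a c) (q + diff b c))
      ≤⟨ sum≤ _ (λ c → ties≤ x y x≢y′ (p + diff a c) (q + diff b c)) ⟩
    (2 + m) * (m * (2 + m) ^ n)                            ≡⟨ x∙yz≈y∙xz (2 + m) m _ ⟩
    m * (2 + m) ^ suc n                                    ∎
    where open ℕ.≤-Reasoning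

  resolvingSet-length≥ : (x y : Vertex (suc n) (2 + m)) → x ≢ y →
                         2 * (2 + m) ^ n ≤ length (resolvingSet hamming x y)
  resolvingSet-length≥ {n} x y x≢y = ℕ.+-cancelʳ-≤ (m * K) (2 * K) R (begin
    2 * K + m * K                     ≡⟨ ℕ.*-distribʳ-+ K 2 m ⟨
    (2 + m) * K                       ≡⟨ length-vertices (suc n) (2 + m) ⟨
    length (vertices (suc n) (2 + m)) ≡⟨ length-filter-∁ (tied? x y 0 0) (vertices (suc n) (2 + m)) ⟨
    R + ties x y 0 0                  ≤⟨ ℕ.+-monoʳ-≤ R (ties≤ x y x≢y 0 0) ⟩
    R + m * K                         ∎)
    where
    open ℕ.≤-Reasoning
    K R : ℕ
    K = (2 + m) ^ n
    R = length (resolvingSet hamming x y)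

-- Rational weights

sumOver-++ : {A : Set} (xs ys : List A) (f : A → ℚ) → sumOver (xs ++ ys) f ≡ sumOver xs f ℚ.+ sumOver ys f
sumOver-++ []       ys f = sym (ℚ.+-identityˡ _)
sumOver-++ (x ∷ xs) ys f = trans (cong (f x ℚ.+_) (sumOver-++ xs ys f)) (sym (ℚ.+-assoc (f x) _ _))

sumOver-map : {A B : Set} (g : A → B) (xs : List A) (f : B → ℚ) → sumOver (map g xs) f ≡ sumOver xs (f ∘ g)
sumOver-map g []       f = refl
sumOver-map g (x ∷ xs) f = cong (f (g x) ℚ.+_) (sumOver-map g xs f)

sumOver-const : {A : Set} (xs : List A) (c : ℚ) → sumOver xs (λ _ → c) ≡ length xs × c
sumOver-const []       c = refl
sumOver-const (x ∷ xs) c = cong (c ℚ.+_) (sumOver-const xs c)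

sumOver-filter≤ : {A : Set} {p : _} {P : Pred A p} (P? : Decidable P) (xs : List A) {f : A → ℚ} →
                  (∀ x → 0ℚ ℚ.≤ f x) → sumOver (filter P? xs) f ℚ.≤ sumOver xs f
sumOver-filter≤ P? []       f≥0 = ℚ.≤-refl
sumOver-filter≤ P? (x ∷ xs) {f} f≥0 with does (P? x)
... | true  = ℚ.+-monoʳ-≤ (f x) (sumOver-filter≤ P? xs f≥0)
... | false = ℚ.≤-trans (ℚ.≤-reflexive (sym (ℚ.+-identityˡ _)))
                        (ℚ.+-mono-≤ (f≥0 x) (sumOver-filter≤ P? xs f≥0))

weight-∷ : (f : Vertex (suc n) k → ℚ) → weight f ≡ ℚΣ.sum (λ c → weight (f ∘ (c ∷_)))
weight-∷ {n} {k} f =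
  trans (ℚΣ.sum-vertices {n = n} {k = k} (λ xs → sumOver xs f) refl (λ xs ys → sumOver-++ xs ys f))
        (ℚΣ.sum-cong-≗ (λ c → sumOver-map (c ∷_) (vertices n k) f))

sumOver-filter-vertices : {p : _} {P : Pred (Vertex (suc n) k) p} (P? : Decidable P) (f : Vertex (suc n) k → ℚ) →
  sumOver (filter P? (vertices (suc n) k)) f ≡
  ℚΣ.sum (λ c → sumOver (filter (P? ∘ (c ∷_)) (vertices n k)) (f ∘ (c ∷_)))
sumOver-filter-vertices {n} {k} P? f =
  trans (ℚΣ.sum-vertices {n = n} {k = k} (λ xs → sumOver (filter P? xs) f) refl
          (λ xs ys → trans (cong (λ zs → sumOver zs f) (List.filter-++ P? xs ys))
                           (sumOver-++ (filter P? xs) _ f)))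
        (ℚΣ.sum-cong-≗ (λ c → trans (cong (λ zs → sumOver zs f) (filter-map P? (c ∷_) (vertices n k)))
                                    (sumOver-map (c ∷_) (filter (P? ∘ (c ∷_)) (vertices n k)) f)))

×-nonNeg : {c : ℚ} → 0ℚ ℚ.≤ c → ∀ n → 0ℚ ℚ.≤ n × c
×-nonNeg c≥0 zero    = ℚ.≤-refl
×-nonNeg c≥0 (suc n) = ℚ.+-mono-≤ c≥0 (×-nonNeg c≥0 n)

×-monoˡ-≤ : {c : ℚ} → 0ℚ ℚ.≤ c → {m n : ℕ} → m ≤ n → m × c ℚ.≤ n × c
×-monoˡ-≤ c≥0 {n = n} z≤n   = ×-nonNeg c≥0 n
×-monoˡ-≤ {c} c≥0 (s≤s m≤n) = ℚ.+-monoʳ-≤ c (×-monoˡ-≤ c≥0 m≤n)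

×-monoʳ-≤ : ∀ n {c d : ℚ} → c ℚ.≤ d → n × c ℚ.≤ n × d
×-monoʳ-≤ zero    c≤d = ℚ.≤-refl
×-monoʳ-≤ (suc n) c≤d = ℚ.+-mono-≤ c≤d (×-monoʳ-≤ n c≤d)

×≤sum : ∀ {n} (g : Vector ℚ n) {c : ℚ} → (∀ i → c ℚ.≤ g i) → n × c ℚ.≤ ℚΣ.sum g
×≤sum {zero}  g c≤g = ℚ.≤-refl
×≤sum {suc n} g c≤g = ℚ.+-mono-≤ (c≤g Fin.zero) (×≤sum (g ∘ Fin.suc) (c≤g ∘ Fin.suc))

-- (+ k) / 2 is the normal form of mkℚᵘ (+ k) 1, so the comparison is made in ℚᵘ.
×½≡/2 : ∀ k → k × ½ ≡ (+ k) / 2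
×½≡/2 k = ℚ.toℚᵘ-injective
  (ℚᵘ.≃-trans (toℚᵘ-×½ k) (ℚᵘ.≃-sym (ℚ.toℚᵘ-fromℚᵘ (ℚᵘ.mkℚᵘ (+ k) 1))))
  where
  open ℤ-Solver
  halves : ∀ i → ((+ 1) ℤ.* (+ 2) ℤ.+ i ℤ.* (+ 2)) ℤ.* (+ 2) ≡ ((+ 1) ℤ.+ i) ℤ.* (+ 4)
  halves = solve 1 (λ i → (con (+ 1) :* con (+ 2) :+ i :* con (+ 2)) :* con (+ 2)
                        := (con (+ 1) :+ i) :* con (+ 4)) refl
  toℚᵘ-×½ : ∀ k → ℚ.toℚᵘ (k × ½) ℚᵘ.≃ ℚᵘ.mkℚᵘ (+ k) 1
  toℚᵘ-×½ zero    = ℚᵘ.*≡* refl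
  toℚᵘ-×½ (suc k) = ℚᵘ.≃-trans (ℚ.toℚᵘ-homo-+ ½ (k × ½))
                      (ℚᵘ.≃-trans (ℚᵘ.+-congʳ (ℚ.toℚᵘ ½) (toℚᵘ-×½ k)) (ℚᵘ.*≡* (halves (+ k))))

-- If F₀ ≥ ½, recurse on the other values; otherwise each of them is at least 1 - F₀ > ½.
pairwise≥1⇒half≤sum : ∀ j (F : Vector ℚ (2 + j)) → (∀ a b → a ≢ b → 1ℚ ℚ.≤ F a ℚ.+ F b) →
                      (2 + j) × ½ ℚ.≤ ℚΣ.sum F
pairwise≥1⇒half≤sum zero F pair =
  ℚ.≤-trans (pair Fin.zero (Fin.suc Fin.zero) (λ ()))
            (ℚ.≤-reflexive (cong (F Fin.zero ℚ.+_) (sym (ℚ.+-identityʳ _))))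
pairwise≥1⇒half≤sum (suc j) F pair with ½ ℚ.≤? F Fin.zero
... | yes ½≤F₀ = ℚ.+-mono-≤ ½≤F₀ (pairwise≥1⇒half≤sum j (F ∘ Fin.suc)
                                    (λ a b a≢b → pair (Fin.suc a) (Fin.suc b) (a≢b ∘ suc-injective)))
... | no  ½≰F₀ = begin
  (3 + j) × ½         ≡⟨ ℚ.+-assoc ½ ½ ((1 + j) × ½) ⟨
  1ℚ ℚ.+ (1 + j) × ½  ≤⟨ ℚ.+-monoʳ-≤ 1ℚ (×-monoʳ-≤ (1 + j) ½≤t) ⟩
  1ℚ ℚ.+ (1 + j) × t  ≡⟨ split-1 F₀ ((1 + j) × t) ⟩
  F₀ ℚ.+ (2 + j) × t  ≤⟨ ℚ.+-monoʳ-≤ F₀ (×≤sum (F ∘ Fin.suc) t≤F) ⟩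
  ℚΣ.sum F            ∎
  where
  open ℚ.≤-Reasoning
  open ℚ-Solver
  F₀ t : ℚ
  F₀ = F Fin.zero
  t = 1ℚ ℚ.- F₀
  ½≤t : ½ ℚ.≤ t
  ½≤t = ℚ.+-monoʳ-≤ 1ℚ (ℚ.neg-antimono-≤ (ℚ.<⇒≤ (ℚ.≰⇒> ½≰F₀)))
  t≤F : ∀ i → t ℚ.≤ F (Fin.suc i)
  t≤F i = ℚ.≤-trans (ℚ.+-monoˡ-≤ (ℚ.- F₀) (pair Fin.zero (Fin.suc i) (λ ())))
                    (ℚ.≤-reflexive (xyx⁻¹≈y F₀ (F (Fin.suc i))))
  split-1 : ∀ f x → 1ℚ ℚ.+ x ≡ f ℚ.+ ((1ℚ ℚ.- f) ℚ.+ x)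
  split-1 = solve 2 (λ f x → con 1ℚ :+ x := f :+ ((con 1ℚ :- f) :+ x)) refl

-- A vertex whose first letter is neither a nor b is equidistant from a ∷ w and b ∷ w.
sumOver-resolvingSet-heads≤ : {m : ℕ} {a b : Fin (2 + m)} → a ≢ b → (w : Vertex n (2 + m)) →
  {f : Vertex (suc n) (2 + m) → ℚ} → (∀ z → 0ℚ ℚ.≤ f z) →
  sumOver (resolvingSet hamming (a ∷ w) (b ∷ w)) f ℚ.≤ weight (f ∘ (a ∷_)) ℚ.+ weight (f ∘ (b ∷_))
sumOver-resolvingSet-heads≤ {n} {m} {a} {b} a≢b w {f} f≥0 = begin
  sumOver (filter resolves? (vertices (suc n) (2 + m))) f ≡⟨ sumOver-filter-vertices resolves? f ⟩
  ℚΣ.sum G                                                ≡⟨ ℚΣ.sum-supported₂ G a≢b G-vanishes ⟩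
  G a ℚ.+ G b                                             ≤⟨ ℚ.+-mono-≤ (G≤weight a) (G≤weight b) ⟩
  weight (f ∘ (a ∷_)) ℚ.+ weight (f ∘ (b ∷_))             ∎
  where
  open ℚ.≤-Reasoning
  resolves? : Decidable (λ z → hamming (a ∷ w) z ≢ hamming (b ∷ w) z)
  resolves? z = ¬? (hamming (a ∷ w) z ℕ.≟ hamming (b ∷ w) z)
  G : Vector ℚ (2 + m)
  G c = sumOver (filter (resolves? ∘ (c ∷_)) (vertices n (2 + m))) (f ∘ (c ∷_))
  G≤weight : ∀ c → G c ℚ.≤ weight (f ∘ (c ∷_))
  G≤weight c = sumOver-filter≤ (resolves? ∘ (c ∷_)) (vertices n (2 + m)) (f≥0 ∘ (c ∷_))
  G-vanishes : ∀ c → c ≢ a → c ≢ b → G c ≡ 0ℚ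
  G-vanishes c c≢a c≢b = cong (λ zs → sumOver zs (f ∘ (c ∷_)))
    (List.filter-none (resolves? ∘ (c ∷_)) (universal equidistant (vertices n (2 + m))))
    where
    equidistant : ∀ u → ¬ ¬ hamming (a ∷ w) (c ∷ u) ≡ hamming (b ∷ w) (c ∷ u)
    equidistant u resolves =
      resolves (cong (_+ hamming w u) (trans (diff-≢ (c≢a ∘ sym)) (sym (diff-≢ (c≢b ∘ sym)))))

resolving-weight≥ : {m : ℕ} (d : Vertex (suc n) (2 + m) → Vertex (suc n) (2 + m) → ℕ) →
  (∀ x z → IsDist x z (d x z)) → (f : Vertex (suc n) (2 + m) → ℚ) → IsResolvingFunction d f →
  (+ (2 + m)) / 2 ℚ.≤ weight f
resolving-weight≥ {n} {m} d isDist f (f∈[0,1] , resolving) = begin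
  (+ (2 + m)) / 2                     ≡⟨ ×½≡/2 (2 + m) ⟨
  (2 + m) × ½                         ≤⟨ pairwise≥1⇒half≤sum m (λ c → weight (f ∘ (c ∷_))) pair ⟩
  ℚΣ.sum (λ c → weight (f ∘ (c ∷_)))  ≡⟨ weight-∷ f ⟨
  weight f                            ∎
  where
  open ℚ.≤-Reasoning
  w : Vertex n (2 + m)
  w = Vec.replicate n Fin.zero
  pair : ∀ a b → a ≢ b → 1ℚ ℚ.≤ weight (f ∘ (a ∷_)) ℚ.+ weight (f ∘ (b ∷_))
  pair a b a≢b = begin
    1ℚ
      ≤⟨ resolving (a ∷ w) (b ∷ w) (a≢b ∘ ∷-injectiveˡ) ⟩
    sumOver (resolvingSet d (a ∷ w) (b ∷ w)) f
      ≡⟨ cong (λ zs → sumOver zs f) (resolvingSet-hamming d isDist (a ∷ w) (b ∷ w)) ⟩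
    sumOver (resolvingSet hamming (a ∷ w) (b ∷ w)) f
      ≤⟨ sumOver-resolvingSet-heads≤ a≢b w (proj₁ ∘ f∈[0,1]) ⟩
    weight (f ∘ (a ∷_)) ℚ.+ weight (f ∘ (b ∷_)) ∎

module _ (M : ℕ) .{{_ : NonZero M}} where

  private instance
    M×1-positive : ℚ.Positive (M × 1ℚ)
    M×1-positive = ℚ.positive
      (ℚ.<-≤-trans (ℚ.positive⁻¹ 1ℚ) (×-monoˡ-≤ (ℚ.nonNegative⁻¹ 1ℚ) (ℕ.>-nonZero⁻¹ M)))
    M×1-nonZero : ℚ.NonZero (M × 1ℚ)
    M×1-nonZero = ℚ.pos⇒nonZero (M × 1ℚ)

  half-over : ℚ
  half-over = ½ ℚ.* ℚ.1/ (M × 1ℚ)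

  half-over-nonNeg : 0ℚ ℚ.≤ half-over
  half-over-nonNeg = ℚ.<⇒≤ (ℚ.positive⁻¹ half-over {{half-over-positive}})
    where
    half-over-positive : ℚ.Positive half-over
    half-over-positive = ℚ.pos*pos⇒pos ½ (ℚ.1/ (M × 1ℚ)) {{ℚ.1/pos⇒pos (M × 1ℚ)}}

  ×half-over : M × half-over ≡ ½
  ×half-over = begin
    M × (½ ℚ.* ℚ.1/ (M × 1ℚ))            ≡⟨ ×-comm-* M ½ _ ⟨
    ½ ℚ.* (M × ℚ.1/ (M × 1ℚ))            ≡⟨ cong (λ x → ½ ℚ.* (M × x)) (ℚ.*-identityˡ _) ⟨
    ½ ℚ.* (M × (1ℚ ℚ.* ℚ.1/ (M × 1ℚ)))   ≡⟨ cong (½ ℚ.*_) (×-assoc-* M 1ℚ _) ⟨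
    ½ ℚ.* ((M × 1ℚ) ℚ.* ℚ.1/ (M × 1ℚ))   ≡⟨ cong (½ ℚ.*_) (ℚ.*-inverseʳ (M × 1ℚ)) ⟩
    ½ ℚ.* 1ℚ                             ≡⟨ ℚ.*-identityʳ ½ ⟩
    ½                                    ∎
    where open ≡.≡-Reasoning

module _ {m : ℕ} .{{_ : NonZero m}} where

  uniform-resolving-function : (d : Vertex (suc n) (2 + m) → Vertex (suc n) (2 + m) → ℕ) →
    (∀ x z → IsDist x z (d x z)) →
    Σ (Vertex (suc n) (2 + m) → ℚ) λ f → IsResolvingFunction d f ∧ (weight f ≡ (+ (2 + m)) / 2)
  uniform-resolving-function {n} d isDist = (λ _ → c) , ((λ _ → c≥0 , c≤1) , resolving) , weight-c
    where
    M : ℕ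
    M = (2 + m) ^ n
    instance
      M≢0 : NonZero M
      M≢0 = ℕ.m^n≢0 (2 + m) n
    c : ℚ
    c = half-over M
    c≥0 : 0ℚ ℚ.≤ c
    c≥0 = half-over-nonNeg M
    2M×c≡1 : (2 * M) × c ≡ 1ℚ
    2M×c≡1 = trans (sym (×-assocˡ c 2 M)) (cong (2 ×_) (×half-over M))
    c≤1 : c ℚ.≤ 1ℚ
    c≤1 = ℚ.≤-trans (ℚ.≤-reflexive (sym (ℚ.+-identityʳ c)))
            (ℚ.≤-trans (×-monoˡ-≤ c≥0 1≤2M) (ℚ.≤-reflexive 2M×c≡1))
      where
      1≤2M : 1 ≤ 2 * M
      1≤2M = ≤-trans (ℕ.>-nonZero⁻¹ M) (ℕ.m≤n*m M 2)
    resolving : ∀ x y → x ≢ y → 1ℚ ℚ.≤ sumOver (resolvingSet d x y) (λ _ → c)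
    resolving x y x≢y = begin
      1ℚ                                      ≡⟨ 2M×c≡1 ⟨
      (2 * M) × c                             ≤⟨ ×-monoˡ-≤ c≥0 (resolvingSet-length≥ x y x≢y) ⟩
      length (resolvingSet hamming x y) × c   ≡⟨ cong (λ zs → length zs × c) (resolvingSet-hamming d isDist x y) ⟨
      length (resolvingSet d x y) × c         ≡⟨ sumOver-const (resolvingSet d x y) c ⟨
      sumOver (resolvingSet d x y) (λ _ → c)  ∎
      where open ℚ.≤-Reasoning
    weight-c : weight {suc n} {2 + m} (λ _ → c) ≡ (+ (2 + m)) / 2
    weight-c = begin
      sumOver (vertices (suc n) (2 + m)) (λ _ → c) ≡⟨ sumOver-const (vertices (suc n) (2 + m)) c ⟩
      length (vertices (suc n) (2 + m)) × c       ≡⟨ cong (_× c) (length-vertices (suc n) (2 + m)) ⟩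
      ((2 + m) * M) × c                           ≡⟨ ×-assocˡ c (2 + m) M ⟨
      (2 + m) × (M × c)                           ≡⟨ cong ((2 + m) ×_) (×half-over M) ⟩
      (2 + m) × ½                                 ≡⟨ ×½≡/2 (2 + m) ⟩
      (+ (2 + m)) / 2                             ∎
      where open ≡.≡-Reasoning

theorem2p5 : (n k : ℕ) → 1 ≤ n → 3 ≤ k →
    (d : Vertex n k → Vertex n k → ℕ) → (∀ x z → IsDist x z (d x z)) →
    FracDimIs d ((+ k) / 2)
theorem2p5 (suc n) (suc (suc (suc j))) (s≤s z≤n) (s≤s (s≤s (s≤s z≤n))) d isDist =
  uniform-resolving-function d isDist , resolving-weight≥ d isDist
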